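{- Let $p$ be prime, let $m$ be a positive integer not divisible by $p$, and fix $\varepsilon\in\{1,-1\}$. Let $n$ be an integer (residue class modulo $p(p-1)$) such that $p^2\mid D_\varepsilon(n,m)$, let $k\equiv m-n\pmod{p(p-1)}$, and let $x$ be any integer with $x\equiv 1-mn^{ -1}\pmod p$. Then $x^k\equiv -\varepsilon(1-x)^m\pmod{p^2}$.
   Context: $D_\varepsilon(n,m)=n^n+\varepsilon (n-m)^{n-m}m^m$ for positive integers $n>m$. Convention: for integers $n,m$ with $p\nmid m$, "$p^2\mid D_\varepsilon(n,m)$" means $p^2\mid D_\varepsilon(n',m')$ for positive integers $m'\equiv m$, $n'\equiv n\pmod{p(p-1)}$ with $n'>m'$ (independent of the choice). Here $n^{ -1}$ denotes an inverse of $n$ modulo $p$, and negative powers denote powers of inverses modulo $p^2$. -}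

module Defs where

open import Data.Nat as ℕ using (ℕ; _∸_)
open import Data.Integer using (ℤ; +_; _+_; _-_; _*_; _^_)
open import Data.Integer.Divisibility using (_∣_)

_≡_[mod_] : ℤ → ℤ → ℕ → Set
a ≡ b [mod d ] = (+ d) ∣ (a - b)

infix 4 _≡_[mod_]

-- D_ε(n,m) = n^n + ε (n-m)^(n-m) m^m   (used for n > m)
D : ℤ → ℕ → ℕ → ℤ
D ε n m = + (n ℕ.^ n) + ε * + ((n ∸ m) ℕ.^ (n ∸ m) ℕ.* m ℕ.^ m)

{-# OPTIONS --safe #-}

-- Put b = m′, c = n′ and a = c − b, so that x ≡ a/c and 1 − x ≡ b/c (mod p). Modulo p² a
-- power of a unit depends on its exponent only modulo p(p − 1) (Euler), so k may be replaced
-- by b − c and m by b. Writing xc = a + ps, the first-order binomial expansion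
-- (a + ps)^j a ≡ a^j (a + jps) (mod p²) expands both sides; after multiplying by a unit W
-- that clears the denominators, the hypothesis ε a^a b^b ≡ −c^c (mod p²) matches the leading
-- terms, and the remaining terms differ by a multiple of ps(kb + ma) with
-- kb + ma ≡ (b − c)b + ba = 0 (mod p).

module Submission where

open import Defs
open import Data.Nat as ℕ using (ℕ; _∸_; _<_; _≤_)
open import Data.Nat.Primality using (Prime)
open import Data.Nat.Divisibility as ℕ using (_∣_)
open import Data.Integer using (ℤ; +_; -_; _+_; _-_; _*_; _^_; 1ℤ; -1ℤ; 0ℤ)
open import Data.Sum using (_⊎_)
open import Relation.Nullary using (¬_)
open import Relation.Binary.PropositionalEquality using (_≡_)

open import Data.Nat using (zero; suc; 2+)
open import Data.Integer using (∣_∣; _%ℕ_; _/ℕ_)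
open import Data.Integer.DivMod using (a≡a%ℕn+[a/ℕn]*n)
import Data.Nat.Properties as ℕ
import Data.Nat.Combinatorics as ℕ
import Data.Integer.Properties as ℤ
import Data.Integer.Divisibility as ℤ
import Data.Integer.Divisibility.Signed as Signed
open import Data.Nat.Primality using (euclidsLemma; ¬prime[0]; ¬prime[1])
import Data.Nat.Tactic.RingSolver as ℕSolver
open import Data.Integer.Tactic.RingSolver using (solve-∀)
import Data.Fin as Fin
import Data.Fin.Properties as Fin
open import Data.Vec.Functional using (Vector; tail; init; last)
open import Data.Product using (∃; _,_; proj₁; proj₂)
open import Data.Sum using ([_,_]; inj₁; inj₂)
open import Function using (id; flip; _∘_)
open import Relation.Nullary using (contradiction)
open import Relation.Binary.Bundles using (Setoid)
import Relation.Binary.PropositionalEquality as ≡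
import Relation.Binary.Reasoning.Setoid as ≈-Reasoning
import Algebra.Properties.CommutativeSemiring.Binomial ℤ.+-*-commutativeSemiring as Binomialℤ
import Algebra.Properties.CommutativeSemiring.Exp ℤ.+-*-commutativeSemiring as Expℤ
open import Algebra.Properties.Semiring.Exp ℤ.+-*-semiring using () renaming (_^_ to _^ᴿ_)
open import Algebra.Properties.Semiring.Mult ℤ.+-*-semiring using (_×_)
open import Algebra.Properties.Semiring.Sum ℤ.+-*-semiring using (sum; sum-init-last)

-- `_≡_[mod_]` unfolds to a statement about `∣ a - b ∣`, from which Agda cannot
-- recover `a` and `b`; this record keeps them inferable.
record _≈_[mod_] (a b : ℤ) (d : ℕ) : Set where
  constructor mod
  field unmod : a ≡ b [mod d ]

infix 4 _≈_[mod_]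

module Mod where

  private
    variable
      d : ℕ
      a b c e : ℤ

    from-signed : a - b ≡ c → + d Signed.∣ c → a ≈ b [mod d ]
    from-signed ≡.refl h = mod (Signed.∣⇒∣ᵤ h)

    to-signed : a ≈ b [mod d ] → + d Signed.∣ (a - b)
    to-signed (mod h) = Signed.∣ᵤ⇒∣ h

  reflexive : a ≡ b → a ≈ b [mod d ]
  reflexive {a = a} ≡.refl = from-signed (ℤ.+-inverseʳ a) (Signed.divides 0ℤ ≡.refl)

  refl : a ≈ a [mod d ]
  refl = reflexive ≡.refl

  sym : a ≈ b [mod d ] → b ≈ a [mod d ]
  sym {a = a} {b = b} h = from-signed (swap a b) (Signed.∣m⇒∣-m (to-signed h))
    where swap : ∀ a b → b - a ≡ - (a - b)
          swap = solve-∀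

  trans : a ≈ b [mod d ] → b ≈ c [mod d ] → a ≈ c [mod d ]
  trans {a = a} {b = b} {c = c} h h′ =
    from-signed (split a b c) (Signed.∣m∣n⇒∣m+n (to-signed h) (to-signed h′))
    where split : ∀ a b c → a - c ≡ (a - b) + (b - c)
          split = solve-∀

  setoid : ℕ → Setoid _ _
  setoid d = record
    { Carrier = ℤ
    ; _≈_ = _≈_[mod d ]
    ; isEquivalence = record { refl = refl ; sym = sym ; trans = trans }
    }

  +-cong : a ≈ b [mod d ] → c ≈ e [mod d ] → a + c ≈ b + e [mod d ]
  +-cong {a = a} {b = b} {c = c} {e = e} h h′ =
    from-signed (split a b c e) (Signed.∣m∣n⇒∣m+n (to-signed h) (to-signed h′))
    where split : ∀ a b c e → (a + c) - (b + e) ≡ (a - b) + (c - e)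
          split = solve-∀

  +-congˡ : ∀ c → a ≈ b [mod d ] → c + a ≈ c + b [mod d ]
  +-congˡ c = +-cong (refl {a = c})

  +-congʳ : ∀ c → a ≈ b [mod d ] → a + c ≈ b + c [mod d ]
  +-congʳ c h = +-cong h (refl {a = c})

  -‿cong : a ≈ b [mod d ] → - a ≈ - b [mod d ]
  -‿cong {a = a} {b = b} h = from-signed (neg a b) (Signed.∣m⇒∣-m (to-signed h))
    where neg : ∀ a b → - a - - b ≡ - (a - b)
          neg = solve-∀

  *-cong : a ≈ b [mod d ] → c ≈ e [mod d ] → a * c ≈ b * e [mod d ]
  *-cong {a = a} {b = b} {c = c} {e = e} h h′ =
    from-signed (split a b c e)
      (Signed.∣m∣n⇒∣m+n (Signed.∣m⇒∣m*n c (to-signed h)) (Signed.∣n⇒∣m*n b (to-signed h′)))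
    where split : ∀ a b c e → a * c - b * e ≡ (a - b) * c + b * (c - e)
          split = solve-∀

  *-congˡ : ∀ c → a ≈ b [mod d ] → c * a ≈ c * b [mod d ]
  *-congˡ c = *-cong (refl {a = c})

  *-congʳ : ∀ c → a ≈ b [mod d ] → a * c ≈ b * c [mod d ]
  *-congʳ c h = *-cong h (refl {a = c})

  ^-cong : ∀ j → a ≈ b [mod d ] → a ^ j ≈ b ^ j [mod d ]
  ^-cong zero    h = refl
  ^-cong (suc j) h = *-cong h (^-cong j h)

  weaken : ∀ {d′} → d ∣ d′ → a ≈ b [mod d′ ] → a ≈ b [mod d ]
  weaken d∣d′ (mod h) = mod (ℕ.∣-trans d∣d′ h)

  by-quotient : ∀ q → a - b ≡ q * + d → a ≈ b [mod d ]
  by-quotient q eq = from-signed eq (Signed.divides q ≡.refl)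

  ∣⇒≈0 : ∀ a → + d ℤ.∣ a → a ≈ 0ℤ [mod d ]
  ∣⇒≈0 a h = from-signed (ℤ.+-identityʳ a) (Signed.∣ᵤ⇒∣ h)

  ≈0⇒∣ : a ≈ 0ℤ [mod d ] → + d ℤ.∣ a
  ≈0⇒∣ {a = a} {d = d} (mod h) = ≡.subst (+ d ℤ.∣_) (ℤ.+-identityʳ a) h

  ∣⇒pos*≈0 : ∀ {n} b → d ∣ n → + n * b ≈ 0ℤ [mod d ]
  ∣⇒pos*≈0 {n = n} b h = *-cong (∣⇒≈0 (+ n) h) (refl {a = b})

  ≈⇒≡+* : a ≈ b [mod d ] → ∃ λ q → a ≡ b + + d * q
  ≈⇒≡+* {a = a} {b = b} {d = d} h with to-signed h
  ... | Signed.divides q a-b≡q*d = q , rearrange a b (+ d) q a-b≡q*d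
    where rearrange : ∀ a b d q → a - b ≡ q * d → a ≡ b + d * q
          rearrange a b d q eq = ≡.trans (shift a b) (≡.cong (_+_ b) (≡.trans eq (ℤ.*-comm q d)))
            where shift : ∀ a b → a ≡ b + (a - b)
                  shift = solve-∀

  a+d*s≈a : ∀ s → a + + d * s ≈ a [mod d ]
  a+d*s≈a {a = a} {d = d} s = by-quotient s (rearrange a (+ d) s)
    where rearrange : ∀ a d s → a + d * s - a ≡ s * d
          rearrange = solve-∀

  pos≈pos⇒∣∸ : ∀ {e f} → e ≤ f → + e ≈ + f [mod d ] → d ∣ f ∸ e
  pos≈pos⇒∣∸ {d = d} {e} {f} e≤f (mod h) =
    ≡.subst (d ∣_) (≡.trans (≡.cong ∣_∣ (ℤ.m-n≡m⊖n e f)) (ℤ.∣⊖∣-≤ e≤f)) h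

  +≈0⇒≈- : a + b ≈ 0ℤ [mod d ] → b ≈ - a [mod d ]
  +≈0⇒≈- {a = a} {b = b} a+b≈0 =
    trans (reflexive (rearrange a b)) (trans (+-congʳ (- a) a+b≈0) (reflexive (ℤ.+-identityˡ (- a))))
    where rearrange : ∀ a b → b ≡ a + b + - a
          rearrange = solve-∀

[1+k]*[1+n]C[1+k]≡[1+n]*nCk : ∀ n k → suc k ℕ.* (suc n ℕ.C suc k) ≡ suc n ℕ.* (n ℕ.C k)
[1+k]*[1+n]C[1+k]≡[1+n]*nCk zero zero = ≡.refl
[1+k]*[1+n]C[1+k]≡[1+n]*nCk zero (suc k)
  rewrite ℕ.k>n⇒nCk≡0 {1} {2 ℕ.+ k} (ℕ.s≤s (ℕ.s≤s ℕ.z≤n)) | ℕ.k>n⇒nCk≡0 {0} {suc k} (ℕ.s≤s ℕ.z≤n)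
  = ℕ.*-zeroʳ (2 ℕ.+ k)
[1+k]*[1+n]C[1+k]≡[1+n]*nCk (suc n) zero rewrite ℕ.nC1≡n (2 ℕ.+ n) =
  ≡.trans (ℕ.+-identityʳ (2 ℕ.+ n)) (≡.sym (ℕ.*-identityʳ (2 ℕ.+ n)))
[1+k]*[1+n]C[1+k]≡[1+n]*nCk (suc n) (suc k) = begin
  2+k ℕ.* (2+n ℕ.C 2+k)
    ≡⟨ ≡.cong (2+k ℕ.*_) (ℕ.nCk+nC[k+1]≡[n+1]C[k+1] (suc n) (suc k)) ⟨
  2+k ℕ.* (A ℕ.+ B)
    ≡⟨ distribute k A B ⟩
  A ℕ.+ suc k ℕ.* A ℕ.+ 2+k ℕ.* B
    ≡⟨ ≡.cong₂ (λ u w → A ℕ.+ u ℕ.+ w) ([1+k]*[1+n]C[1+k]≡[1+n]*nCk n k) ([1+k]*[1+n]C[1+k]≡[1+n]*nCk n (suc k)) ⟩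
  A ℕ.+ suc n ℕ.* (n ℕ.C k) ℕ.+ suc n ℕ.* (n ℕ.C suc k)
    ≡⟨ collect A (suc n) (n ℕ.C k) (n ℕ.C suc k) ⟩
  A ℕ.+ suc n ℕ.* (n ℕ.C k ℕ.+ n ℕ.C suc k)
    ≡⟨ ≡.cong (λ t → A ℕ.+ suc n ℕ.* t) (ℕ.nCk+nC[k+1]≡[n+1]C[k+1] n k) ⟩
  A ℕ.+ suc n ℕ.* A
    ∎
  where
  open ≡.≡-Reasoning
  2+k 2+n A B : ℕ
  2+k = 2 ℕ.+ k
  2+n = 2 ℕ.+ n
  A = suc n ℕ.C suc k
  B = suc n ℕ.C 2+k
  distribute : ∀ k A B → (2 ℕ.+ k) ℕ.* (A ℕ.+ B) ≡ A ℕ.+ suc k ℕ.* A ℕ.+ (2 ℕ.+ k) ℕ.* B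
  distribute = ℕSolver.solve-∀
  collect : ∀ A N X Y → A ℕ.+ N ℕ.* X ℕ.+ N ℕ.* Y ≡ A ℕ.+ N ℕ.* (X ℕ.+ Y)
  collect = ℕSolver.solve-∀

p∣pCk : ∀ {p k} → Prime p → 0 < k → k < p → p ∣ p ℕ.C k
p∣pCk {suc n} {suc k} p-prime _ k<p =
  [ (λ p∣k → contradiction (ℕ.∣⇒≤ p∣k) (ℕ.<⇒≱ k<p)) , id ]
    (euclidsLemma (suc k) (suc n ℕ.C suc k) p-prime
      (ℕ.divides (n ℕ.C k) (≡.trans ([1+k]*[1+n]C[1+k]≡[1+n]*nCk n k) (ℕ.*-comm (suc n) (n ℕ.C k)))))

module _ {p : ℕ} (p-prime : Prime p) where

  p∤1 : ¬ (p ∣ 1)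
  p∤1 p∣1 = ¬prime[1] (≡.subst Prime (ℕ.∣1⇒≡1 p∣1) p-prime)

  p∤±1 : ∀ {ε} → ε ≡ 1ℤ ⊎ ε ≡ -1ℤ → ¬ (+ p ℤ.∣ ε)
  p∤±1 (inj₁ ≡.refl) = p∤1
  p∤±1 (inj₂ ≡.refl) = p∤1

  euclidsLemmaℤ : ∀ a b → + p ℤ.∣ a * b → + p ℤ.∣ a ⊎ + p ℤ.∣ b
  euclidsLemmaℤ a b h = euclidsLemma ∣ a ∣ ∣ b ∣ p-prime (≡.subst (p ∣_) (ℤ.abs-* a b) h)

  ∤-* : ∀ a b → ¬ (+ p ℤ.∣ a) → ¬ (+ p ℤ.∣ b) → ¬ (+ p ℤ.∣ a * b)
  ∤-* a b p∤a p∤b p∣ab = [ p∤a , p∤b ] (euclidsLemmaℤ a b p∣ab)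

  ∣^⇒∣ : ∀ a j → + p ℤ.∣ a ^ j → + p ℤ.∣ a
  ∣^⇒∣ a zero    p∣1 = contradiction p∣1 p∤1
  ∣^⇒∣ a (suc j) p∣aaʲ = [ id , ∣^⇒∣ a j ] (euclidsLemmaℤ a (a ^ j) p∣aaʲ)

  ∤-^ : ∀ a j → ¬ (+ p ℤ.∣ a) → ¬ (+ p ℤ.∣ a ^ j)
  ∤-^ a j p∤a = p∤a ∘ ∣^⇒∣ a j

∣⇒∣^ : ∀ {d} a {j} → 0 < j → + d ℤ.∣ a → + d ℤ.∣ a ^ j
∣⇒∣^ {d} a {suc j} _ d∣a = ≡.subst (d ∣_) (≡.sym (ℤ.abs-* a (a ^ j))) (ℕ.∣m⇒∣m*n ∣ a ^ j ∣ d∣a)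

-- `_^ᴿ_` and `_×_` are the power and the multiple of the semiring library, in which the
-- binomial theorem is stated.
^ᴿ≡^ : ∀ u j → u ^ᴿ j ≡ u ^ j
^ᴿ≡^ u zero    = ≡.refl
^ᴿ≡^ u (suc j) = ≡.cong (u *_) (^ᴿ≡^ u j)

×≡pos* : ∀ n u → n × u ≡ + n * u
×≡pos* zero    u = ≡.sym (ℤ.*-zeroˡ u)
×≡pos* (suc n) u = ≡.trans (≡.cong (_+_ u) (×≡pos* n u)) (step (+ n) u)
  where step : ∀ n u → u + n * u ≡ (1ℤ + n) * u
        step = solve-∀

sum≈0 : ∀ {d n} (f : Vector ℤ n) → (∀ i → f i ≈ 0ℤ [mod d ]) → sum f ≈ 0ℤ [mod d ]
sum≈0 {n = zero}  f f≈0 = Mod.refl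
sum≈0 {n = suc n} f f≈0 = Mod.+-cong (f≈0 Fin.zero) (sum≈0 (tail f) (f≈0 ∘ Fin.suc))

[1+u]^p≈1+u^p : ∀ {p} → Prime p → ∀ u → (1ℤ + u) ^ p ≈ 1ℤ + u ^ p [mod p ]
[1+u]^p≈1+u^p {zero}  p-prime = contradiction p-prime ¬prime[0]
[1+u]^p≈1+u^p {suc n} p-prime u = begin
  (1ℤ + u) ^ suc n
    ≡⟨ ^ᴿ≡^ (1ℤ + u) (suc n) ⟨
  (1ℤ + u) ^ᴿ suc n
    ≡⟨ Binomialℤ.theorem (suc n) 1ℤ u ⟩
  t Fin.zero + sum (tail t)
    ≡⟨ ≡.cong (_+_ (t Fin.zero)) (sum-init-last (tail t)) ⟩
  t Fin.zero + (sum (init (tail t)) + last (tail t))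
    ≈⟨ Mod.+-congˡ (t Fin.zero) (Mod.+-congʳ (last (tail t)) (sum≈0 (init (tail t)) middle≈0)) ⟩
  t Fin.zero + (0ℤ + last (tail t))
    ≡⟨ ≡.cong₂ (λ a b → a + (0ℤ + b)) first≡u^p last≡1 ⟩
  u ^ suc n + (0ℤ + 1ℤ)
    ≡⟨ ℤ.+-comm (u ^ suc n) 1ℤ ⟩
  1ℤ + u ^ suc n
    ∎
  where
  open ≈-Reasoning (Mod.setoid (suc n))
  t : Vector ℤ (2+ n)
  t = Binomialℤ.binomialTerm 1ℤ u (suc n)

  first≡u^p : t Fin.zero ≡ u ^ suc n
  first≡u^p = ≡.trans (ℤ.+-identityʳ _) (≡.trans (ℤ.*-identityˡ _) (^ᴿ≡^ u (suc n)))

  last≡1 : last (tail t) ≡ 1ℤ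
  last≡1 rewrite Fin.toℕ-fromℕ n | ℕ.nCn≡1 (suc n) | ℕ.n∸n≡0 n =
    ≡.trans (ℤ.+-identityʳ _) (≡.trans (ℤ.*-identityʳ _) (≡.trans (^ᴿ≡^ 1ℤ (suc n)) (ℤ.^-zeroˡ (suc n))))

  middle≈0 : ∀ i → init (tail t) i ≈ 0ℤ [mod suc n ]
  middle≈0 i = Mod.trans (Mod.reflexive (×≡pos* (suc n ℕ.C k) b))
                         (Mod.∣⇒pos*≈0 b (p∣pCk p-prime (ℕ.s≤s ℕ.z≤n) k<p))
    where
    k : ℕ
    k = suc (Fin.toℕ (Fin.inject₁ i))
    b : ℤ
    b = Binomialℤ.binomial 1ℤ u (suc n) (Fin.suc (Fin.inject₁ i))
    k<p : k < suc n
    k<p = ℕ.s≤s (≡.subst (_< n) (≡.sym (Fin.toℕ-inject₁ i)) (Fin.toℕ<n i))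

^-distrib-* : ∀ u v j → (u * v) ^ j ≡ u ^ j * v ^ j
^-distrib-* u v j = begin
  (u * v) ^ j          ≡⟨ ^ᴿ≡^ (u * v) j ⟨
  (u * v) ^ᴿ j         ≡⟨ Expℤ.^-distrib-* u v j ⟩
  u ^ᴿ j * v ^ᴿ j      ≡⟨ ≡.cong₂ _*_ (^ᴿ≡^ u j) (^ᴿ≡^ v j) ⟩
  u ^ j * v ^ j        ∎
  where open ≡.≡-Reasoning

fermat : ∀ {p} → Prime p → ∀ u → u ^ p ≈ u [mod p ]
fermat {zero}      p-prime = contradiction p-prime ¬prime[0]
fermat {p@(suc _)} p-prime u = begin
  u ^ p      ≈⟨ Mod.^-cong p u≈r ⟩
  (+ r) ^ p  ≈⟨ fermatℕ r ⟩
  + r        ≈⟨ u≈r ⟨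
  u          ∎
  where
  open ≈-Reasoning (Mod.setoid p)
  r : ℕ
  r = u %ℕ p

  u≈r : u ≈ + r [mod p ]
  u≈r = Mod.by-quotient (u /ℕ p) (rearrange (a≡a%ℕn+[a/ℕn]*n u p))
    where rearrange : ∀ {u r s} → u ≡ r + s → u - r ≡ s
          rearrange {r = r} {s = s} ≡.refl = cancel r s
            where cancel : ∀ r s → r + s - r ≡ s
                  cancel = solve-∀

  fermatℕ : ∀ v → (+ v) ^ p ≈ + v [mod p ]
  fermatℕ zero    = Mod.refl
  fermatℕ (suc v) = begin
    (1ℤ + + v) ^ p  ≈⟨ [1+u]^p≈1+u^p p-prime (+ v) ⟩
    1ℤ + (+ v) ^ p  ≈⟨ Mod.+-congˡ 1ℤ (fermatℕ v) ⟩
    1ℤ + + v        ∎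

^[p-1]≈1 : ∀ {p} → Prime p → ∀ {u} → ¬ (+ p ℤ.∣ u) → u ^ (p ∸ 1) ≈ 1ℤ [mod p ]
^[p-1]≈1 {zero}      p-prime = contradiction p-prime ¬prime[0]
^[p-1]≈1 {p@(suc n)} p-prime {u} p∤u =
  [ flip contradiction p∤u , p∣uⁿ-1⇒uⁿ≈1 ] (euclidsLemmaℤ p-prime u (u ^ n - 1ℤ) (Mod.≈0⇒∣ u*[u^n-1]≈0))
  where
  p∣uⁿ-1⇒uⁿ≈1 : + p ℤ.∣ u ^ n - 1ℤ → u ^ n ≈ 1ℤ [mod p ]
  p∣uⁿ-1⇒uⁿ≈1 = mod

  open ≈-Reasoning (Mod.setoid p)
  u*[u^n-1]≈0 : u * (u ^ n - 1ℤ) ≈ 0ℤ [mod p ]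
  u*[u^n-1]≈0 = begin
    u * (u ^ n - 1ℤ) ≡⟨ expand u (u ^ n) ⟩
    u ^ p - u        ≈⟨ Mod.+-congʳ (- u) (fermat p-prime u) ⟩
    u - u            ≡⟨ ℤ.+-inverseʳ u ⟩
    0ℤ               ∎
    where expand : ∀ u v → u * (v - 1ℤ) ≡ u * v - u
          expand = solve-∀

[a+ds]^j*a≈a^j*[a+jds] : ∀ d a s j →
  (a + + d * s) ^ j * a ≈ a ^ j * (a + + j * (+ d * s)) [mod d ℕ.* d ]
[a+ds]^j*a≈a^j*[a+jds] d a s zero    = Mod.reflexive (≡.cong (1ℤ *_) (≡.sym (ℤ.+-identityʳ a)))
[a+ds]^j*a≈a^j*[a+jds] d a s (suc j) = begin
  (a + t) ^ suc j * a
    ≡⟨ ℤ.*-assoc (a + t) ((a + t) ^ j) a ⟩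
  (a + t) * ((a + t) ^ j * a)
    ≈⟨ Mod.*-congˡ (a + t) ([a+ds]^j*a≈a^j*[a+jds] d a s j) ⟩
  (a + t) * (a ^ j * (a + + j * t))
    ≡⟨ expand a (a ^ j) (+ j) (+ d) s ⟩
  a ^ suc j * (a + + suc j * t) + + d * + d * (a ^ j * + j * s * s)
    ≡⟨ ≡.cong (λ d² → a ^ suc j * (a + + suc j * t) + d² * (a ^ j * + j * s * s)) (ℤ.pos-* d d) ⟨
  a ^ suc j * (a + + suc j * t) + + (d ℕ.* d) * (a ^ j * + j * s * s)
    ≈⟨ Mod.a+d*s≈a (a ^ j * + j * s * s) ⟩
  a ^ suc j * (a + + suc j * t)
    ∎
  where
  open ≈-Reasoning (Mod.setoid (d ℕ.* d))
  t : ℤ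
  t = + d * s
  expand : ∀ a aʲ j d s → (a + d * s) * (aʲ * (a + j * (d * s)))
                        ≡ a * aʲ * (a + (1ℤ + j) * (d * s)) + d * d * (aʲ * j * s * s)
  expand = solve-∀

module _ {p : ℕ} (p-prime : Prime p) {u : ℤ} (p∤u : ¬ (+ p ℤ.∣ u)) where

  euler : u ^ (p ℕ.* (p ∸ 1)) ≈ 1ℤ [mod p ℕ.* p ]
  euler with Mod.≈⇒≡+* (^[p-1]≈1 p-prime p∤u)
  ... | s , u^[p-1]≡1+ps = begin
    u ^ (p ℕ.* (p ∸ 1))              ≡⟨ ≡.cong (u ^_) (ℕ.*-comm p (p ∸ 1)) ⟩
    u ^ ((p ∸ 1) ℕ.* p)              ≡⟨ ≡.trans (ℤ.*-identityʳ _) (ℤ.^-*-assoc u (p ∸ 1) p) ⟨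
    (u ^ (p ∸ 1)) ^ p * 1ℤ           ≡⟨ ≡.cong (λ v → v ^ p * 1ℤ) u^[p-1]≡1+ps ⟩
    (1ℤ + + p * s) ^ p * 1ℤ          ≈⟨ [a+ds]^j*a≈a^j*[a+jds] p 1ℤ s p ⟩
    1ℤ ^ p * (1ℤ + + p * (+ p * s))  ≡⟨ ≡.cong (_* (1ℤ + + p * (+ p * s))) (ℤ.^-zeroˡ p) ⟩
    1ℤ * (1ℤ + + p * (+ p * s))      ≡⟨ regroup (+ p) s ⟩
    1ℤ + + p * + p * s               ≡⟨ ≡.cong (λ p² → 1ℤ + p² * s) (ℤ.pos-* p p) ⟨
    1ℤ + + (p ℕ.* p) * s             ≈⟨ Mod.a+d*s≈a s ⟩
    1ℤ                               ∎
    where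
    open ≈-Reasoning (Mod.setoid (p ℕ.* p))
    regroup : ∀ p s → 1ℤ * (1ℤ + p * (p * s)) ≡ 1ℤ + p * p * s
    regroup = solve-∀

  ^-periodic : ∀ e t → u ^ (e ℕ.+ t ℕ.* (p ℕ.* (p ∸ 1))) ≈ u ^ e [mod p ℕ.* p ]
  ^-periodic e t = begin
    u ^ (e ℕ.+ t ℕ.* N)   ≡⟨ ℤ.^-distribˡ-+-* u e (t ℕ.* N) ⟩
    u ^ e * u ^ (t ℕ.* N) ≡⟨ ≡.cong (λ j → u ^ e * u ^ j) (ℕ.*-comm t N) ⟩
    u ^ e * u ^ (N ℕ.* t) ≡⟨ ≡.cong (u ^ e *_) (ℤ.^-*-assoc u N t) ⟨
    u ^ e * (u ^ N) ^ t   ≈⟨ Mod.*-congˡ (u ^ e) (Mod.^-cong t euler) ⟩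
    u ^ e * 1ℤ ^ t        ≡⟨ ≡.cong (u ^ e *_) (ℤ.^-zeroˡ t) ⟩
    u ^ e * 1ℤ            ≡⟨ ℤ.*-identityʳ (u ^ e) ⟩
    u ^ e                 ∎
    where
    open ≈-Reasoning (Mod.setoid (p ℕ.* p))
    N : ℕ
    N = p ℕ.* (p ∸ 1)

  ^-cong-exponent-≤ : ∀ {e f} → e ≤ f → + e ≈ + f [mod p ℕ.* (p ∸ 1) ] → u ^ f ≈ u ^ e [mod p ℕ.* p ]
  ^-cong-exponent-≤ {e} {f} e≤f e≈f with Mod.pos≈pos⇒∣∸ e≤f e≈f
  ... | ℕ.divides t f∸e≡t*N = begin
    u ^ f                              ≡⟨ ≡.cong (u ^_) (ℕ.m+[n∸m]≡n e≤f) ⟨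
    u ^ (e ℕ.+ (f ∸ e))                ≡⟨ ≡.cong (λ j → u ^ (e ℕ.+ j)) f∸e≡t*N ⟩
    u ^ (e ℕ.+ t ℕ.* (p ℕ.* (p ∸ 1)))  ≈⟨ ^-periodic e t ⟩
    u ^ e                              ∎
    where open ≈-Reasoning (Mod.setoid (p ℕ.* p))

  ^-cong-exponent : ∀ {e f} → + e ≈ + f [mod p ℕ.* (p ∸ 1) ] → u ^ e ≈ u ^ f [mod p ℕ.* p ]
  ^-cong-exponent {e} {f} e≈f with ℕ.≤-total e f
  ... | inj₁ e≤f = Mod.sym (^-cong-exponent-≤ e≤f e≈f)
  ... | inj₂ f≤e = ^-cong-exponent-≤ f≤e (Mod.sym e≈f)

*≈0⇒≈0 : ∀ {p} → Prime p → ∀ {w z} → ¬ (+ p ℤ.∣ w) →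
         w * z ≈ 0ℤ [mod p ℕ.* p ] → z ≈ 0ℤ [mod p ℕ.* p ]
*≈0⇒≈0 {0}        p-prime = contradiction p-prime ¬prime[0]
*≈0⇒≈0 {1}        p-prime = contradiction p-prime ¬prime[1]
*≈0⇒≈0 {p@(2+ r)} p-prime {w} {z} p∤w wz≈0 = begin
  z                        ≡⟨ ℤ.*-identityˡ z ⟨
  1ℤ * z                   ≈⟨ Mod.*-congʳ z (euler p-prime {w} p∤w) ⟨
  w ^ (p ℕ.* (p ∸ 1)) * z  ≡⟨ regroup w (w ^ j) z ⟩
  w ^ j * (w * z)          ≈⟨ Mod.*-congˡ (w ^ j) wz≈0 ⟩
  w ^ j * 0ℤ               ≡⟨ ℤ.*-zeroʳ (w ^ j) ⟩
  0ℤ                       ∎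
  where
  open ≈-Reasoning (Mod.setoid (p ℕ.* p))
  -- As p ≥ 2, p(p − 1) reduces to suc j, so w ^ j is an inverse of w modulo p².
  j : ℕ
  j = ℕ.pred (p ℕ.* (p ∸ 1))
  regroup : ∀ w wʲ z → w * wʲ * z ≡ wʲ * (w * z)
  regroup = solve-∀

module NonDivisibility {p : ℕ} (p-prime : Prime p) {ε : ℤ} (ε≡±1 : ε ≡ 1ℤ ⊎ ε ≡ -1ℤ) {a b c : ℕ}
  (c≡a+b : c ≡ a ℕ.+ b) (0<a : 0 < a) (0<c : 0 < c) (p∤b : ¬ (+ p ℤ.∣ + b))
  (εaᵃbᵇ≈-cᶜ : ε * ((+ a) ^ a * (+ b) ^ b) ≈ - (+ c) ^ c [mod p ])
  where

  private
    A B C : ℤ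
    A = + a
    B = + b
    C = + c

    p∣c⇒p∣a⊎p∣b : + p ℤ.∣ C → + p ℤ.∣ A ⊎ + p ℤ.∣ B
    p∣c⇒p∣a⊎p∣b p∣C =
      [ flip contradiction (p∤±1 p-prime ε≡±1) , p∣aᵃbᵇ⇒p∣a⊎p∣b ]
        (euclidsLemmaℤ p-prime ε (A ^ a * B ^ b) (Mod.≈0⇒∣ εaᵃbᵇ≈0))
      where
      p∣aᵃbᵇ⇒p∣a⊎p∣b : + p ℤ.∣ A ^ a * B ^ b → + p ℤ.∣ A ⊎ + p ℤ.∣ B
      p∣aᵃbᵇ⇒p∣a⊎p∣b p∣aᵃbᵇ = [ inj₁ ∘ ∣^⇒∣ p-prime A a , inj₂ ∘ ∣^⇒∣ p-prime B b ]
                                 (euclidsLemmaℤ p-prime (A ^ a) (B ^ b) p∣aᵃbᵇ)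

      open ≈-Reasoning (Mod.setoid p)
      εaᵃbᵇ≈0 : ε * (A ^ a * B ^ b) ≈ 0ℤ [mod p ]
      εaᵃbᵇ≈0 = begin
        ε * (A ^ a * B ^ b)  ≈⟨ εaᵃbᵇ≈-cᶜ ⟩
        - C ^ c              ≈⟨ Mod.-‿cong (Mod.∣⇒≈0 (C ^ c) (∣⇒∣^ C 0<c p∣C)) ⟩
        0ℤ                   ∎

    p∣a⇒p∣c : + p ℤ.∣ A → + p ℤ.∣ C
    p∣a⇒p∣c p∣A = ∣^⇒∣ p-prime C c (Mod.≈0⇒∣ Cᶜ≈0)
      where
      open ≈-Reasoning (Mod.setoid p)
      Cᶜ≈0 : C ^ c ≈ 0ℤ [mod p ]
      Cᶜ≈0 = begin
        C ^ c                    ≡⟨ ℤ.neg-involutive (C ^ c) ⟨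
        - - C ^ c                ≈⟨ Mod.-‿cong εaᵃbᵇ≈-cᶜ ⟨
        - (ε * (A ^ a * B ^ b))  ≈⟨ Mod.-‿cong (Mod.*-congˡ ε (Mod.*-congʳ (B ^ b) Aᵃ≈0)) ⟩
        - (ε * (0ℤ * B ^ b))     ≡⟨ ≡.cong -_ (ℤ.*-zeroʳ ε) ⟩
        0ℤ                       ∎
        where Aᵃ≈0 : A ^ a ≈ 0ℤ [mod p ]
              Aᵃ≈0 = Mod.∣⇒≈0 (A ^ a) (∣⇒∣^ A 0<a p∣A)

  p∤c : ¬ (+ p ℤ.∣ C)
  p∤c p∣C = [ p∤b ∘ p∣b , p∤b ] (p∣c⇒p∣a⊎p∣b p∣C)
    where
    p∣b : + p ℤ.∣ A → + p ℤ.∣ B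
    p∣b p∣A = Mod.≈0⇒∣ (begin
      B        ≡⟨ ≡.trans (≡.cong (λ γ → + γ - A) c≡a+b) (cancel A B) ⟨
      C - A    ≈⟨ Mod.+-cong (Mod.∣⇒≈0 C p∣C) (Mod.-‿cong (Mod.∣⇒≈0 A p∣A)) ⟩
      0ℤ       ∎)
      where
      open ≈-Reasoning (Mod.setoid p)
      cancel : ∀ A B → A + B - A ≡ B
      cancel = solve-∀

  p∤a : ¬ (+ p ℤ.∣ A)
  p∤a = p∤c ∘ p∣a⇒p∣c

module _ {p : ℕ} (p-prime : Prime p) {ε x : ℤ} {a b c k m : ℕ}
  (c≡a+b : c ≡ a ℕ.+ b)
  (p∤a : ¬ (+ p ℤ.∣ + a)) (p∤b : ¬ (+ p ℤ.∣ + b)) (p∤c : ¬ (+ p ℤ.∣ + c))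
  (εaᵃbᵇ≈-cᶜ : ε * ((+ a) ^ a * (+ b) ^ b) ≈ - (+ c) ^ c [mod p ℕ.* p ])
  (k+c≈b : + (k ℕ.+ c) ≈ + b [mod p ℕ.* (p ∸ 1) ])
  (m≈b : + m ≈ + b [mod p ℕ.* (p ∸ 1) ])
  (xc≈a : x * + c ≈ + a [mod p ])
  where

  private
    A B C K M P y : ℤ
    A = + a
    B = + b
    C = + c
    K = + k
    M = + m
    P = + p
    y = 1ℤ - x

    C≡A+B : C ≡ A + B
    C≡A+B = ≡.cong +_ c≡a+b

    s : ℤ
    s = proj₁ (Mod.≈⇒≡+* xc≈a)

    xC≡A+Ps : x * C ≡ A + P * s
    xC≡A+Ps = proj₂ (Mod.≈⇒≡+* xc≈a)

    yC≡B-Ps : y * C ≡ B + P * - s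
    yC≡B-Ps = begin
      (1ℤ - x) * C         ≡⟨ expand x C ⟩
      C - x * C            ≡⟨ ≡.cong₂ _-_ C≡A+B xC≡A+Ps ⟩
      A + B - (A + P * s)  ≡⟨ cancel A B P s ⟩
      B + P * - s          ∎
      where
      open ≡.≡-Reasoning
      expand : ∀ x C → (1ℤ - x) * C ≡ C - x * C
      expand = solve-∀
      cancel : ∀ A B P s → A + B - (A + P * s) ≡ B + P * - s
      cancel = solve-∀

    KB+MA≈0 : K * B + M * A ≈ 0ℤ [mod p ]
    KB+MA≈0 = begin
      K * B + M * A                ≡⟨ ≡.cong (λ t → t * B + M * A) (add-sub K C) ⟩
      (K + C - C) * B + M * A
        ≈⟨ Mod.+-cong (Mod.*-congʳ B (Mod.+-congʳ (- C) (weaken k+c≈b))) (Mod.*-congʳ A (weaken m≈b)) ⟩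
      (B - C) * B + B * A          ≡⟨ ≡.cong (λ t → (B - t) * B + B * A) C≡A+B ⟩
      (B - (A + B)) * B + B * A    ≡⟨ vanish A B ⟩
      0ℤ                           ∎
      where
      open ≈-Reasoning (Mod.setoid p)
      weaken : ∀ {u v} → u ≈ v [mod p ℕ.* (p ∸ 1) ] → u ≈ v [mod p ]
      weaken = Mod.weaken (ℕ.m∣m*n (p ∸ 1))
      add-sub : ∀ K C → K ≡ K + C - C
      add-sub = solve-∀
      vanish : ∀ A B → (B - (A + B)) * B + B * A ≡ 0ℤ
      vanish = solve-∀

    r : ℤ
    r = proj₁ (Mod.≈⇒≡+* KB+MA≈0)

    KB+MA≡Pr : K * B + M * A ≡ P * r
    KB+MA≡Pr = ≡.trans (proj₂ (Mod.≈⇒≡+* KB+MA≈0)) (ℤ.+-identityˡ (P * r))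

    scaled-expansion : ∀ {u e σ} j → u * C ≡ e + P * σ → u ^ j * C ^ j * e ≈ e ^ j * (e + + j * (P * σ)) [mod p ℕ.* p ]
    scaled-expansion {u} {e} {σ} j uC≡e+Pσ = begin
      u ^ j * C ^ j * e    ≡⟨ ≡.cong (_* e) (^-distrib-* u C j) ⟨
      (u * C) ^ j * e      ≡⟨ ≡.cong (λ v → v ^ j * e) uC≡e+Pσ ⟩
      (e + P * σ) ^ j * e  ≈⟨ [a+ds]^j*a≈a^j*[a+jds] p e σ j ⟩
      e ^ j * (e + + j * (P * σ)) ∎
      where open ≈-Reasoning (Mod.setoid (p ℕ.* p))

    Aᵏ⁺ᶜ≈Aᵇ : A ^ (k ℕ.+ c) ≈ A ^ b [mod p ℕ.* p ]
    Aᵏ⁺ᶜ≈Aᵇ = ^-cong-exponent p-prime {A} p∤a k+c≈b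

    Bᵐ≈Bᵇ : B ^ m ≈ B ^ b [mod p ℕ.* p ]
    Bᵐ≈Bᵇ = ^-cong-exponent p-prime {B} p∤b m≈b

    Cᵏ⁺ᶜ⁺ᶜ≈Cᵐ⁺ᶜ : C ^ (k ℕ.+ c ℕ.+ c) ≈ C ^ (m ℕ.+ c) [mod p ℕ.* p ]
    Cᵏ⁺ᶜ⁺ᶜ≈Cᵐ⁺ᶜ = ^-cong-exponent p-prime {C} p∤c (Mod.+-congʳ C (Mod.trans k+c≈b (Mod.sym m≈b)))

    -- W is a unit that clears the denominators c^k and c^m.
    W T U V : ℤ
    W = C ^ k * C ^ m * C ^ c * A ^ c * A * B
    T = A ^ b * C ^ (m ℕ.+ c)
    U = A + K * (P * s)
    V = B + M * (P * - s)

    xᵏW≈TBU : x ^ k * W ≈ T * (B * U) [mod p ℕ.* p ]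
    xᵏW≈TBU = begin
      x ^ k * W
        ≡⟨ regroup (x ^ k) (C ^ k) (C ^ m) (C ^ c) (A ^ c) A B ⟩
      x ^ k * C ^ k * A * (C ^ m * C ^ c * A ^ c * B)
        ≈⟨ Mod.*-congʳ (C ^ m * C ^ c * A ^ c * B) (scaled-expansion k xC≡A+Ps) ⟩
      A ^ k * U * (C ^ m * C ^ c * A ^ c * B)
        ≡⟨ regroup′ (A ^ k) U (C ^ m) (C ^ c) (A ^ c) B ⟩
      A ^ k * A ^ c * (C ^ m * C ^ c) * (B * U)
        ≡⟨ ≡.cong₂ (λ α γ → α * γ * (B * U)) (ℤ.^-distribˡ-+-* A k c) (ℤ.^-distribˡ-+-* C m c) ⟨
      A ^ (k ℕ.+ c) * C ^ (m ℕ.+ c) * (B * U)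
        ≈⟨ Mod.*-congʳ (B * U) (Mod.*-congʳ (C ^ (m ℕ.+ c)) Aᵏ⁺ᶜ≈Aᵇ) ⟩
      T * (B * U)
        ∎
      where
      open ≈-Reasoning (Mod.setoid (p ℕ.* p))
      regroup : ∀ xᵏ Cᵏ Cᵐ Cᶜ Aᶜ A B → xᵏ * (Cᵏ * Cᵐ * Cᶜ * Aᶜ * A * B) ≡ xᵏ * Cᵏ * A * (Cᵐ * Cᶜ * Aᶜ * B)
      regroup = solve-∀
      regroup′ : ∀ Aᵏ U Cᵐ Cᶜ Aᶜ B → Aᵏ * U * (Cᵐ * Cᶜ * Aᶜ * B) ≡ Aᵏ * Aᶜ * (Cᵐ * Cᶜ) * (B * U)
      regroup′ = solve-∀

    εyᵐW≈-TAV : ε * y ^ m * W ≈ - (T * (A * V)) [mod p ℕ.* p ]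
    εyᵐW≈-TAV = begin
      ε * y ^ m * W
        ≡⟨ regroup ε (y ^ m) (C ^ k) (C ^ m) (C ^ c) (A ^ c) A B ⟩
      ε * (y ^ m * C ^ m * B) * (C ^ k * C ^ c * A ^ c * A)
        ≈⟨ Mod.*-congʳ R (Mod.*-congˡ ε (Mod.trans (scaled-expansion m yC≡B-Ps) (Mod.*-congʳ V Bᵐ≈Bᵇ))) ⟩
      ε * (B ^ b * V) * (C ^ k * C ^ c * A ^ c * A)
        ≡⟨ ≡.cong (λ α → ε * (B ^ b * V) * (C ^ k * C ^ c * α * A))
                  (≡.trans (≡.cong (A ^_) c≡a+b) (ℤ.^-distribˡ-+-* A a b)) ⟩
      ε * (B ^ b * V) * (C ^ k * C ^ c * (A ^ a * A ^ b) * A)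
        ≡⟨ regroup′ ε (B ^ b) V (C ^ k) (C ^ c) (A ^ a) (A ^ b) A ⟩
      ε * (A ^ a * B ^ b) * (A ^ b * (C ^ k * C ^ c) * (A * V))
        ≈⟨ Mod.*-congʳ (A ^ b * (C ^ k * C ^ c) * (A * V)) εaᵃbᵇ≈-cᶜ ⟩
      - C ^ c * (A ^ b * (C ^ k * C ^ c) * (A * V))
        ≡⟨ regroup″ (C ^ c) (A ^ b) (C ^ k) (A * V) ⟩
      - (A ^ b * (C ^ k * C ^ c * C ^ c) * (A * V))
        ≡⟨ ≡.cong (λ γ → - (A ^ b * γ * (A * V)))
                  (≡.trans (ℤ.^-distribˡ-+-* C (k ℕ.+ c) c) (≡.cong (_* C ^ c) (ℤ.^-distribˡ-+-* C k c))) ⟨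
      - (A ^ b * C ^ (k ℕ.+ c ℕ.+ c) * (A * V))
        ≈⟨ Mod.-‿cong (Mod.*-congʳ (A * V) (Mod.*-congˡ (A ^ b) Cᵏ⁺ᶜ⁺ᶜ≈Cᵐ⁺ᶜ)) ⟩
      - (T * (A * V))
        ∎
      where
      open ≈-Reasoning (Mod.setoid (p ℕ.* p))
      R : ℤ
      R = C ^ k * C ^ c * A ^ c * A
      regroup : ∀ ε yᵐ Cᵏ Cᵐ Cᶜ Aᶜ A B →
                ε * yᵐ * (Cᵏ * Cᵐ * Cᶜ * Aᶜ * A * B) ≡ ε * (yᵐ * Cᵐ * B) * (Cᵏ * Cᶜ * Aᶜ * A)
      regroup = solve-∀
      regroup′ : ∀ ε Bᵇ V Cᵏ Cᶜ Aᵃ Aᵇ A →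
                 ε * (Bᵇ * V) * (Cᵏ * Cᶜ * (Aᵃ * Aᵇ) * A) ≡ ε * (Aᵃ * Bᵇ) * (Aᵇ * (Cᵏ * Cᶜ) * (A * V))
      regroup′ = solve-∀
      regroup″ : ∀ Cᶜ Aᵇ Cᵏ X → - Cᶜ * (Aᵇ * (Cᵏ * Cᶜ) * X) ≡ - (Aᵇ * (Cᵏ * Cᶜ * Cᶜ) * X)
      regroup″ = solve-∀

    W[xᵏ+εyᵐ]≈0 : W * (x ^ k + ε * y ^ m) ≈ 0ℤ [mod p ℕ.* p ]
    W[xᵏ+εyᵐ]≈0 = begin
      W * (x ^ k + ε * y ^ m)              ≡⟨ distribute W (x ^ k) ε (y ^ m) ⟩
      x ^ k * W + ε * y ^ m * W            ≈⟨ Mod.+-cong xᵏW≈TBU εyᵐW≈-TAV ⟩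
      T * (B * U) + - (T * (A * V))        ≡⟨ factor T A B K M P s ⟩
      T * P * s * (K * B + M * A)          ≡⟨ ≡.cong (T * P * s *_) KB+MA≡Pr ⟩
      T * P * s * (P * r)                  ≡⟨ factor′ T P s r ⟩
      0ℤ + P * P * (T * s * r)             ≡⟨ ≡.cong (λ p² → 0ℤ + p² * (T * s * r)) (ℤ.pos-* p p) ⟨
      0ℤ + + (p ℕ.* p) * (T * s * r)       ≈⟨ Mod.a+d*s≈a (T * s * r) ⟩
      0ℤ                                   ∎
      where
      open ≈-Reasoning (Mod.setoid (p ℕ.* p))
      distribute : ∀ W xᵏ ε yᵐ → W * (xᵏ + ε * yᵐ) ≡ xᵏ * W + ε * yᵐ * W
      distribute = solve-∀
      factor : ∀ T A B K M P s → T * (B * (A + K * (P * s))) + - (T * (A * (B + M * (P * - s))))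
                                 ≡ T * P * s * (K * B + M * A)
      factor = solve-∀
      factor′ : ∀ T P s r → T * P * s * (P * r) ≡ 0ℤ + P * P * (T * s * r)
      factor′ = solve-∀

    p∤W : ¬ (+ p ℤ.∣ W)
    p∤W = ∤-* p-prime (Cᵏᵐᶜ * A ^ c * A) B (∤-* p-prime (Cᵏᵐᶜ * A ^ c) A
            (∤-* p-prime Cᵏᵐᶜ (A ^ c) p∤Cᵏᵐᶜ (∤-^ p-prime A c p∤a)) p∤a) p∤b
      where
      Cᵏᵐᶜ : ℤ
      Cᵏᵐᶜ = C ^ k * C ^ m * C ^ c
      p∤Cᵏᵐᶜ : ¬ (+ p ℤ.∣ Cᵏᵐᶜ)
      p∤Cᵏᵐᶜ = ∤-* p-prime (C ^ k * C ^ m) (C ^ c)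
                 (∤-* p-prime (C ^ k) (C ^ m) (∤-^ p-prime C k p∤c) (∤-^ p-prime C m p∤c)) (∤-^ p-prime C c p∤c)

  xᵏ≈-ε[1-x]ᵐ : x ^ k ≈ - (ε * (1ℤ - x) ^ m) [mod p ℕ.* p ]
  xᵏ≈-ε[1-x]ᵐ = begin
    x ^ k                              ≡⟨ add-sub (x ^ k) (ε * y ^ m) ⟩
    x ^ k + ε * y ^ m + - (ε * y ^ m)
      ≈⟨ Mod.+-congʳ (- (ε * y ^ m)) (*≈0⇒≈0 p-prime {W} p∤W W[xᵏ+εyᵐ]≈0) ⟩
    0ℤ + - (ε * y ^ m)                 ≡⟨ ℤ.+-identityˡ _ ⟩
    - (ε * y ^ m)                      ∎
    where
    open ≈-Reasoning (Mod.setoid (p ℕ.* p))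
    add-sub : ∀ u v → u ≡ u + v + - v
    add-sub = solve-∀

x*n≈n-m : ∀ {d x m m′ n n′ n⁻¹} → n⁻¹ * n ≈ 1ℤ [mod d ] → n′ ≈ n [mod d ] → m ≈ m′ [mod d ] →
          x ≈ 1ℤ - m * n⁻¹ [mod d ] → x * n′ ≈ n′ - m′ [mod d ]
x*n≈n-m {d} {x} {m} {m′} {n} {n′} {n⁻¹} n⁻¹n≈1 n′≈n m≈m′ x≈1-mn⁻¹ = begin
  x * n′                  ≈⟨ Mod.*-congʳ n′ x≈1-mn⁻¹ ⟩
  (1ℤ - m * n⁻¹) * n′     ≡⟨ expand m n⁻¹ n′ ⟩
  n′ - m * (n⁻¹ * n′)     ≈⟨ Mod.+-congˡ n′ (Mod.-‿cong (Mod.*-cong m≈m′ (Mod.trans (Mod.*-congˡ n⁻¹ n′≈n) n⁻¹n≈1))) ⟩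
  n′ - m′ * 1ℤ            ≡⟨ ≡.cong (λ t → n′ - t) (ℤ.*-identityʳ m′) ⟩
  n′ - m′                 ∎
  where
  open ≈-Reasoning (Mod.setoid d)
  expand : ∀ m n⁻¹ n′ → (1ℤ - m * n⁻¹) * n′ ≡ n′ - m * (n⁻¹ * n′)
  expand = solve-∀

k≈m-n⇒k+n′≈m′ : ∀ {d k m m′ n n′} → k ≈ m - n [mod d ] → n′ ≈ n [mod d ] → m ≈ m′ [mod d ] →
                k + n′ ≈ m′ [mod d ]
k≈m-n⇒k+n′≈m′ {d} {k} {m} {m′} {n} {n′} k≈m-n n′≈n m≈m′ = begin
  k + n′      ≈⟨ Mod.+-cong k≈m-n n′≈n ⟩
  m - n + n   ≡⟨ sub-add m n ⟩
  m           ≈⟨ m≈m′ ⟩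
  m′          ∎
  where
  open ≈-Reasoning (Mod.setoid d)
  sub-add : ∀ m n → m - n + n ≡ m
  sub-add = solve-∀

pos-^ : ∀ v j → + (v ℕ.^ j) ≡ (+ v) ^ j
pos-^ v zero    = ≡.refl
pos-^ v (suc j) = ≡.trans (ℤ.pos-* v (v ℕ.^ j)) (≡.cong (+ v *_) (pos-^ v j))

D≈0⇒ε[n-m]ⁿ⁻ᵐmᵐ≈-nⁿ : ∀ {d} ε n m → D ε n m ≡ 0ℤ [mod d ] →
                      ε * ((+ (n ∸ m)) ^ (n ∸ m) * (+ m) ^ m) ≈ - (+ n) ^ n [mod d ]
D≈0⇒ε[n-m]ⁿ⁻ᵐmᵐ≈-nⁿ {d} ε n m D≈0 = Mod.+≈0⇒≈- (≡.subst (λ t → t ≈ 0ℤ [mod d ]) D≡ (mod D≈0))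
  where
  D≡ : D ε n m ≡ (+ n) ^ n + ε * ((+ (n ∸ m)) ^ (n ∸ m) * (+ m) ^ m)
  D≡ = ≡.cong₂ (λ u v → u + ε * v) (pos-^ n n)
         (≡.trans (ℤ.pos-* ((n ∸ m) ℕ.^ (n ∸ m)) (m ℕ.^ m)) (≡.cong₂ _*_ (pos-^ (n ∸ m) (n ∸ m)) (pos-^ m m)))

proposition3p3 :
    (p : ℕ) → Prime p →
    (m : ℕ) → 1 ≤ m → ¬ (p ℕ.∣ m) →
    (ε : ℤ) → (ε ≡ 1ℤ ⊎ ε ≡ -1ℤ) →
    (n : ℤ) →
    (n′ m′ : ℕ) → 1 ≤ m′ → m′ < n′ →
    + n′ ≡ n [mod p ℕ.* (p ∸ 1) ] →
    + m′ ≡ + m [mod p ℕ.* (p ∸ 1) ] →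
    D ε n′ m′ ≡ 0ℤ [mod p ℕ.* p ] →
    (k : ℕ) → + k ≡ + m - n [mod p ℕ.* (p ∸ 1) ] →
    (ninv : ℤ) → ninv * n ≡ 1ℤ [mod p ] →
    (x : ℤ) → x ≡ 1ℤ - + m * ninv [mod p ] →
    x ^ k ≡ - (ε * (1ℤ - x) ^ m) [mod p ℕ.* p ]
proposition3p3 p p-prime m _ p∤m ε ε≡±1 n n′ m′ _ m′<n′ n′≡n m′≡m D≡0 k k≡m-n ninv ninv*n≡1 x x≡1-m*ninv =
  _≈_[mod_].unmod (xᵏ≈-ε[1-x]ᵐ p-prime {ε} n′≡a+m′ p∤a p∤m′ p∤n′ εaᵃm′ᵐ′≈-n′ⁿ′ k+n′≈m′ m≈m′ xn′≈a)
  where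
  a : ℕ
  a = n′ ∸ m′

  n′≡a+m′ : n′ ≡ a ℕ.+ m′
  n′≡a+m′ = ≡.sym (ℕ.m∸n+n≡m (ℕ.<⇒≤ m′<n′))

  mod-p : ∀ {u v} → u ≈ v [mod p ℕ.* (p ∸ 1) ] → u ≈ v [mod p ]
  mod-p = Mod.weaken (ℕ.m∣m*n (p ∸ 1))

  m≈m′ : + m ≈ + m′ [mod p ℕ.* (p ∸ 1) ]
  m≈m′ = Mod.sym (mod m′≡m)

  n′≈n : + n′ ≈ n [mod p ℕ.* (p ∸ 1) ]
  n′≈n = mod n′≡n

  p∤m′ : ¬ (+ p ℤ.∣ + m′)
  p∤m′ p∣m′ = p∤m (Mod.≈0⇒∣ (Mod.trans (mod-p m≈m′) (Mod.∣⇒≈0 (+ m′) p∣m′)))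

  εaᵃm′ᵐ′≈-n′ⁿ′ : ε * ((+ a) ^ a * (+ m′) ^ m′) ≈ - (+ n′) ^ n′ [mod p ℕ.* p ]
  εaᵃm′ᵐ′≈-n′ⁿ′ = D≈0⇒ε[n-m]ⁿ⁻ᵐmᵐ≈-nⁿ ε n′ m′ D≡0

  open NonDivisibility p-prime ε≡±1 n′≡a+m′ (ℕ.m<n⇒0<n∸m m′<n′) (ℕ.≤-<-trans ℕ.z≤n m′<n′) p∤m′
         (Mod.weaken (ℕ.m∣m*n p) εaᵃm′ᵐ′≈-n′ⁿ′) renaming (p∤c to p∤n′)

  k+n′≈m′ : + (k ℕ.+ n′) ≈ + m′ [mod p ℕ.* (p ∸ 1) ]
  k+n′≈m′ = k≈m-n⇒k+n′≈m′ {k = + k} {m = + m} {n = n} (mod k≡m-n) n′≈n m≈m′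

  xn′≈a : x * + n′ ≈ + a [mod p ]
  xn′≈a = Mod.trans (x*n≈n-m {x = x} {m = + m} {n⁻¹ = ninv}
                       (mod ninv*n≡1) (mod-p n′≈n) (mod-p m≈m′) (mod x≡1-m*ninv))
                    (Mod.reflexive (≡.trans (ℤ.m-n≡m⊖n n′ m′) (ℤ.⊖-≥ (ℕ.<⇒≤ m′<n′))))
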